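{- Let $\Sigma$ be a finite alphabet with $s=|\Sigma|\ge 2$, let $k\ge 1$, and let $\alpha,\beta\in\Sigma^k$ be two $k$-mers with Hamming distance $d(\alpha,\beta)=d$. For nonnegative integers $i,j$ let $n^{ij}(\alpha,\beta)=|N_i(\alpha)\cap N_j(\beta)|$, where $N_q(\alpha)=\{\gamma\in\Sigma^k : d(\alpha,\gamma)=q\}$. Then $$n^{ij}(\alpha,\beta)= \sum_{t=0}^{\frac{i+j-d}{2}}\binom{2d - i-j+2t}{d-(i-t)} \binom{d}{i+j-2t-d} (s -2)^{i+j-2t-d} \binom{k-d}{t} (s-1)^t,$$ where the sum ranges over integers $t$ with $0\le t\le \frac{i+j-d}{2}$ (and is empty if $i+j<d$).
   Context: $d(\cdot,\cdot)$ denotes Hamming distance on $\Sigma^k$ (number of positions at which two $k$-mers differ). Binomial coefficients $\binom{a}{b}$ are interpreted as $0$ unless $0\le b\le a$, and $0^0=1$. -}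

module Defs where

open import Data.Nat using (ℕ; zero; suc; _+_; _*_; _∸_; _^_; _<ᵇ_; _/_)
open import Data.Nat.Combinatorics using (_C_)
open import Data.Integer using (ℤ; +_; -[1+_])
import Data.Integer as ℤ
open import Data.Fin using (Fin)
import Data.Fin as Fin
open import Data.Vec using (Vec; []; _∷_)
open import Data.List using (List; map; upTo)
open import Data.Nat.ListAction using (sum)
open import Data.Bool using (if_then_else_)
open import Relation.Nullary.Decidable using (does)

ham : ∀ {s k} → Vec (Fin s) k → Vec (Fin s) k → ℕ
ham [] [] = 0
ham (x ∷ xs) (y ∷ ys) = (if does (x Fin.≟ y) then 0 else 1) + ham xs ys

-- Binomial coefficient with integer arguments: 0 unless 0 ≤ b ≤ a.
-- (Data.Nat.Combinatorics._C_ already gives 0 when b > a.)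
Cℤ : ℤ → ℤ → ℕ
Cℤ (+ a) (+ b) = a C b
Cℤ (+ a) -[1+ b ] = 0
Cℤ -[1+ a ] _ = 0

term : (s k d i j t : ℕ) → ℕ
term s k d i j t =
  Cℤ ((+ (2 * d + 2 * t)) ℤ.- (+ (i + j))) ((+ (d + t)) ℤ.- (+ i))
  * (d C e) * ((s ∸ 2) ^ e) * ((k ∸ d) C t) * ((s ∸ 1) ^ t)
  where
  -- e = i + j - 2t - d, nonnegative for t in the summation range
  e = (i + j ∸ d) ∸ 2 * t

formula : (s k d i j : ℕ) → ℕ
formula s k d i j =
  if (i + j) <ᵇ d then 0
  else sum (map (term s k d i j) (upTo (suc ((i + j ∸ d) / 2))))

-- The numbers n^{ij}(α, β) are the coefficients of the generating polynomial Σ_γ x^{d(α,γ)} y^{d(β,γ)},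
-- which factors over the k positions: a position where α and β agree contributes 1 + (s−1)xy, one
-- where they differ contributes x + y + (s−2)xy. Expanding (1 + (s−1)xy)^{k−d} binomially (t counts
-- the agreeing positions where γ deviates) and (x + y + (s−2)xy)^d as a trinomial (γ copies α, copies
-- β, or takes a third letter) gives the formula.

module Submission where

open import Defs
open import Data.Bool using (true; false; T; if_then_else_)
open import Data.Empty using (⊥-elim)
open import Data.Fin using (Fin; punchIn; punchOut)
import Data.Fin as Fin
open import Data.Fin.Properties using (+↔⊎; punchInᵢ≢i; punchIn-punchOut; punchIn-injective)
open import Data.Integer using (-[1+_]) renaming (+_ to pos)
import Data.Integer as ℤ
import Data.Integer.Properties as ℤ
open import Data.List using (map; upTo; applyUpTo)
open import Data.Nat using (ℕ; zero; suc; _+_; _*_; _∸_; _^_; _≤_; _<_; _<ᵇ_; z≤n; s≤s)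
open import Data.Nat.Combinatorics using (_C_; nCk+nC[k+1]≡[n+1]C[k+1]; k>n⇒nCk≡0; nCn≡1)
open import Data.Nat.DivMod using (_/_; m/n*n≤m; m*n/n≡m; /-mono-≤)
open import Data.Nat.GeneralisedArithmetic using (fold)
open import Data.Nat.ListAction using () renaming (sum to sumList)
open import Data.Nat.Properties
open import Algebra.Properties.CommutativeMonoid.Sum +-0-commutativeMonoid using (sum; sum-remove)
open import Data.Nat.Tactic.RingSolver using (solve-∀)
open import Data.Product using (Σ; _×_; _,_)
open import Data.Product.Function.Dependent.Propositional using (congˡ)
open import Data.Product.Function.NonDependent.Propositional using (_×-↔_)
open import Data.Sum using (_⊎_; inj₁; inj₂)
open import Data.Sum.Function.Propositional using (_⊎-↔_)
open import Data.Unit using (tt)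
open import Data.Vec using (Vec; []; _∷_)
open import Function.Base using (id; _∘_)
open import Function.Bundles using (_↔_; mk↔ₛ′)
open import Function.Properties.Inverse using (↔-refl; ↔-sym; ↔-trans)
open import Relation.Binary.PropositionalEquality
open import Relation.Nullary using (¬_; yes; no)
open import Relation.Nullary.Decidable using (does; dec-true; dec-false)

¬⇒↔Fin0 : {A : Set} → ¬ A → A ↔ Fin 0
¬⇒↔Fin0 ¬a = mk↔ₛ′ (⊥-elim ∘ ¬a) (λ ()) (λ ()) (⊥-elim ∘ ¬a)

suc≡suc↔≡ : {m n : ℕ} → (suc m ≡ suc n) ↔ (m ≡ n)
suc≡suc↔≡ = mk↔ₛ′ suc-injective (cong suc) (λ _ → ≡-irrelevant _ _) (λ _ → ≡-irrelevant _ _)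

Σ-Fin-suc↔⊎ : ∀ {n} (P : Fin (suc n) → Set) → Σ (Fin (suc n)) P ↔ (P Fin.zero ⊎ Σ (Fin n) (P ∘ Fin.suc))
Σ-Fin-suc↔⊎ P = mk↔ₛ′
  (λ { (Fin.zero , p) → inj₁ p ; (Fin.suc z , p) → inj₂ (z , p) })
  (λ { (inj₁ p) → Fin.zero , p ; (inj₂ (z , p)) → Fin.suc z , p })
  (λ { (inj₁ p) → refl ; (inj₂ (z , p)) → refl })
  (λ { (Fin.zero , p) → refl ; (Fin.suc z , p) → refl })

Σ-Fin↔Fin-sum : ∀ {n} (P : Fin n → Set) (f : Fin n → ℕ) →
  (∀ z → P z ↔ Fin (f z)) → Σ (Fin n) P ↔ Fin (sum f)
Σ-Fin↔Fin-sum {zero} P f P↔ = ¬⇒↔Fin0 λ ()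
Σ-Fin↔Fin-sum {suc n} P f P↔ = ↔-trans (Σ-Fin-suc↔⊎ P)
  (↔-trans (P↔ Fin.zero ⊎-↔ Σ-Fin↔Fin-sum (P ∘ Fin.suc) (f ∘ Fin.suc) (P↔ ∘ Fin.suc))
    (↔-sym +↔⊎))

sum-const : ∀ {m} (g : Fin m → ℕ) {B} → (∀ z → g z ≡ B) → sum g ≡ m * B
sum-const {zero}  g g≡B = refl
sum-const {suc m} g g≡B = cong₂ _+_ (g≡B Fin.zero) (sum-const (g ∘ Fin.suc) (g≡B ∘ Fin.suc))

sum-one-point : ∀ {m} (g : Fin (suc m) → ℕ) x {A B} →
  g x ≡ A → (∀ z → x ≢ z → g z ≡ B) → sum g ≡ A + m * B
sum-one-point g x gx≡A g≡B = trans (sum-remove {i = x} g)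
  (cong₂ _+_ gx≡A (sum-const (g ∘ punchIn x) λ z → g≡B (punchIn x z) (punchInᵢ≢i x z ∘ sym)))

sum-two-points : ∀ {m} (g : Fin (suc (suc m)) → ℕ) {x y} → x ≢ y → ∀ {A B C} →
  g x ≡ A → g y ≡ B → (∀ z → x ≢ z → y ≢ z → g z ≡ C) → sum g ≡ A + B + m * C
sum-two-points {m} g {x} {y} x≢y {A} {B} {C} gx≡A gy≡B g≡C = trans (sum-remove {i = x} g)
  (trans (cong (g x +_) (sum-one-point (g ∘ punchIn x) (punchOut x≢y)
                          (trans (cong g (punchIn-punchOut x≢y)) gy≡B) g≡C′))
    (trans (cong (_+ (B + m * C)) gx≡A) (sym (+-assoc A B (m * C)))))
  where
  g≡C′ : ∀ z → punchOut x≢y ≢ z → g (punchIn x z) ≡ C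
  g≡C′ z y′≢z = g≡C (punchIn x z) (punchInᵢ≢i x z ∘ sym)
    λ y≡ → y′≢z (punchIn-injective x _ z (trans (punchIn-punchOut x≢y) y≡))

sumBelow : ℕ → (ℕ → ℕ) → ℕ
sumBelow zero    f = 0
sumBelow (suc m) f = f 0 + sumBelow m (f ∘ suc)

syntax sumBelow m (λ t → e) = ∑[ t < m ] e

sumBelow-cong : ∀ m {f g} → (∀ t → t < m → f t ≡ g t) → sumBelow m f ≡ sumBelow m g
sumBelow-cong zero    f≡g = refl
sumBelow-cong (suc m) f≡g = cong₂ _+_ (f≡g 0 (s≤s z≤n)) (sumBelow-cong m λ t t<m → f≡g (suc t) (s≤s t<m))

sumBelow-zero : ∀ m {f} → (∀ t → f t ≡ 0) → sumBelow m f ≡ 0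
sumBelow-zero zero    f≡0 = refl
sumBelow-zero (suc m) f≡0 = cong₂ _+_ (f≡0 0) (sumBelow-zero m (f≡0 ∘ suc))

sumBelow-+ : ∀ m f g → ∑[ t < m ] (f t + g t) ≡ sumBelow m f + sumBelow m g
sumBelow-+ zero    f g = refl
sumBelow-+ (suc m) f g = trans (cong (f 0 + g 0 +_) (sumBelow-+ m (f ∘ suc) (g ∘ suc)))
  (interchange (f 0) (g 0) _ _)
  where
  interchange : ∀ a b c d → a + b + (c + d) ≡ a + c + (b + d)
  interchange = solve-∀

sumBelow-* : ∀ m c f → ∑[ t < m ] (c * f t) ≡ c * sumBelow m f
sumBelow-* zero    c f = sym (*-zeroʳ c)
sumBelow-* (suc m) c f = trans (cong (c * f 0 +_) (sumBelow-* m c (f ∘ suc)))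
  (sym (*-distribˡ-+ c (f 0) _))

sumBelow-suc : ∀ m f → sumBelow (suc m) f ≡ sumBelow m f + f m
sumBelow-suc zero    f = +-comm (f 0) 0
sumBelow-suc (suc m) f = trans (cong (f 0 +_) (sumBelow-suc m (f ∘ suc))) (sym (+-assoc (f 0) _ _))

sumBelow-vanishing : ∀ m r {f} → (∀ t → m ≤ t → f t ≡ 0) → sumBelow (m + r) f ≡ sumBelow m f
sumBelow-vanishing m zero    {f} f≡0 = cong (λ l → sumBelow l f) (+-identityʳ m)
sumBelow-vanishing m (suc r) {f} f≡0 = begin
  sumBelow (m + suc r) f          ≡⟨ cong (λ l → sumBelow l f) (+-suc m r) ⟩
  sumBelow (suc (m + r)) f        ≡⟨ sumBelow-suc (m + r) f ⟩
  sumBelow (m + r) f + f (m + r)  ≡⟨ cong₂ _+_ (sumBelow-vanishing m r f≡0) (f≡0 (m + r) (m≤m+n m r)) ⟩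
  sumBelow m f + 0                ≡⟨ +-identityʳ _ ⟩
  sumBelow m f                    ∎
  where open ≡-Reasoning

sumBelow-support : ∀ m m′ {f} → (∀ t → m ≤ t → f t ≡ 0) → (∀ t → m′ ≤ t → f t ≡ 0) →
  sumBelow m f ≡ sumBelow m′ f
sumBelow-support m m′ {f} f≡0 f≡0′ with ≤-total m m′
... | inj₁ m≤m′ = sym (trans (cong (λ l → sumBelow l f) (sym (m+[n∸m]≡n m≤m′)))
                         (sumBelow-vanishing m (m′ ∸ m) f≡0))
... | inj₂ m′≤m = trans (cong (λ l → sumBelow l f) (sym (m+[n∸m]≡n m′≤m)))
                    (sumBelow-vanishing m′ (m ∸ m′) f≡0′)

sum-map-upTo : ∀ f m → sumList (map f (upTo m)) ≡ sumBelow m f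
sum-map-upTo f m = go f id m
  where
  go : ∀ f g m → sumList (map f (applyUpTo g m)) ≡ ∑[ t < m ] f (g t)
  go f g zero    = refl
  go f g (suc m) = cong (f (g 0) +_) (go f (g ∘ suc) m)

≤-half⇒double≤ : ∀ m t → t ≤ m / 2 → 2 * t ≤ m
≤-half⇒double≤ m t t≤m/2 = ≤-trans (*-monoʳ-≤ 2 t≤m/2) (subst (_≤ m) (*-comm (m / 2) 2) (m/n*n≤m m 2))

double≤⇒≤-half : ∀ m t → 2 * t ≤ m → t ≤ m / 2
double≤⇒≤-half m t 2t≤m =
  subst (_≤ m / 2) (trans (cong (_/ 2) (*-comm 2 t)) (m*n/n≡m t 2)) (/-mono-≤ 2t≤m (≤-refl {2}))

k>n⇒nCk*m≡0 : ∀ n k → n < k → ∀ m → (n C k) * m ≡ 0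
k>n⇒nCk*m≡0 n k n<k m = cong (_* m) (k>n⇒nCk≡0 n<k)

sumBelow-pascal : ∀ A (w : ℕ → ℕ) →
  ∑[ t < suc (suc A) ] ((suc A C t) * w t) ≡
  ∑[ t < suc A ] ((A C t) * w t) + ∑[ t < suc A ] ((A C t) * w (suc t))
sumBelow-pascal A w = begin
  1 * w 0 + ∑[ t < suc A ] ((suc A C suc t) * w (suc t))
    ≡⟨ cong (1 * w 0 +_) (sumBelow-cong (suc A) {g = λ t → old t + new t} λ t _ → pascal t) ⟩
  1 * w 0 + ∑[ t < suc A ] (old t + new t)
    ≡⟨ cong (1 * w 0 +_) (trans (sumBelow-+ (suc A) old new) (+-comm (sumBelow (suc A) old) _)) ⟩
  1 * w 0 + (sumBelow (suc A) new + sumBelow (suc A) old)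
    ≡⟨ sym (+-assoc (1 * w 0) (sumBelow (suc A) new) (sumBelow (suc A) old)) ⟩
  sumBelow (suc (suc A)) same + sumBelow (suc A) old
    ≡⟨ cong (_+ sumBelow (suc A) old) (sumBelow-suc (suc A) same) ⟩
  sumBelow (suc A) same + same (suc A) + sumBelow (suc A) old
    ≡⟨ cong (λ x → sumBelow (suc A) same + x + sumBelow (suc A) old)
         (k>n⇒nCk*m≡0 A (suc A) ≤-refl (w (suc A))) ⟩
  sumBelow (suc A) same + 0 + sumBelow (suc A) old
    ≡⟨ cong (_+ sumBelow (suc A) old) (+-identityʳ (sumBelow (suc A) same)) ⟩
  sumBelow (suc A) same + sumBelow (suc A) old ∎
  where
  open ≡-Reasoning
  same old new : ℕ → ℕ
  same t = (A C t) * w t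
  old  t = (A C t) * w (suc t)
  new  t = (A C suc t) * w (suc t)
  pascal : ∀ t → (suc A C suc t) * w (suc t) ≡ old t + new t
  pascal t = trans (cong (_* w (suc t)) (sym (nCk+nC[k+1]≡[n+1]C[k+1] A t)))
                   (*-distribʳ-+ (w (suc t)) (A C t) (A C suc t))

lower : (ℕ → ℕ) → ℕ → ℕ
lower f zero    = 0
lower f (suc x) = f x

binomial-rec : ∀ a b → 0 < a + b →
  (a + b) C a ≡ lower (λ a′ → (a′ + b) C a′) a + lower (λ b′ → (a + b′) C a) b
binomial-rec zero    (suc b) _ = refl
binomial-rec (suc a) zero    _ = begin
  (suc a + 0) C suc a  ≡⟨ cong (_C suc a) (+-identityʳ (suc a)) ⟩
  suc a C suc a        ≡⟨ nCn≡1 (suc a) ⟩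
  1                    ≡⟨ sym (nCn≡1 a) ⟩
  a C a                ≡⟨ cong (_C a) (sym (+-identityʳ a)) ⟩
  (a + 0) C a          ≡⟨ sym (+-identityʳ _) ⟩
  (a + 0) C a + 0      ∎
  where open ≡-Reasoning
binomial-rec (suc a) (suc b) _ = begin
  suc (a + suc b) C suc a                   ≡⟨ sym (nCk+nC[k+1]≡[n+1]C[k+1] (a + suc b) a) ⟩
  (a + suc b) C a + (a + suc b) C suc a     ≡⟨ cong (λ m → (a + suc b) C a + m C suc a) (+-suc a b) ⟩
  (a + suc b) C a + (suc a + b) C suc a     ∎
  where open ≡-Reasoning

pos[m+n]-pos-m≡pos-n : ∀ m n → pos (m + n) ℤ.- pos m ≡ pos n
pos[m+n]-pos-m≡pos-n m n = trans (ℤ.m-n≡m⊖n (m + n) m) (trans (ℤ.⊖-≥ (m≤m+n m n)) (cong pos (m+n∸m≡n m n)))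

pos-m-pos[1+m+r]≡-[1+r] : ∀ m r → pos m ℤ.- pos (suc (m + r)) ≡ -[1+ r ]
pos-m-pos[1+m+r]≡-[1+r] m r = trans (ℤ.m-n≡m⊖n m (suc (m + r)))
  (trans (ℤ.⊖-< (s≤s (m≤m+n m r))) (cong (λ x → ℤ.- (pos x)) (trans (cong (_∸ m) (sym (+-suc m r))) (m+n∸m≡n m (suc r)))))

Cℤ-negʳ : ∀ x r → Cℤ x -[1+ r ] ≡ 0
Cℤ-negʳ (pos x)  r = refl
Cℤ-negʳ -[1+ x ] r = refl

Cℤ-vanishing : ∀ X Y x r → X + suc r ≡ Y + x → Cℤ (pos X ℤ.- pos Y) (pos x) ≡ 0
Cℤ-vanishing X Y x r X+1+r≡Y+x with Y ≤? X
... | yes Y≤X with m≤n⇒∃[o]m+o≡n Y≤X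
...   | z , refl = trans (cong (λ a → Cℤ a (pos x)) (pos[m+n]-pos-m≡pos-n Y z)) (k>n⇒nCk≡0 z<x)
  where
  z<x : z < x
  z<x = subst (z <_) (+-cancelˡ-≡ Y _ _ (trans (sym (+-assoc Y z (suc r))) X+1+r≡Y+x)) (m<m+n z (s≤s z≤n))
Cℤ-vanishing X Y x r _ | no Y≰X with m≤n⇒∃[o]m+o≡n (≰⇒> Y≰X)
... | u , refl = cong (λ a → Cℤ a (pos x)) (pos-m-pos[1+m+r]≡-[1+r] X u)

-- Coefficient arrays of bivariate polynomials

-- f i j is the coefficient of xⁱ yʲ, and shift a b f is xᵃ yᵇ f.
Coeffs : Set
Coeffs = ℕ → ℕ → ℕ

_≋_ : Coeffs → Coeffs → Set
f ≋ g = ∀ i j → f i j ≡ g i j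

one : Coeffs
one zero zero = 1
one _    _    = 0

_⊕_ : Coeffs → Coeffs → Coeffs
(f ⊕ g) i j = f i j + g i j

_⊛_ : ℕ → Coeffs → Coeffs
(c ⊛ f) i j = c * f i j

infix  4 _≋_
infixl 6 _⊕_
infixl 7 _⊛_

shift : ℕ → ℕ → Coeffs → Coeffs
shift zero    zero    f i       j       = f i j
shift (suc a) b       f zero    j       = 0
shift (suc a) b       f (suc i) j       = shift a b f i j
shift zero    (suc b) f i       zero    = 0
shift zero    (suc b) f i       (suc j) = shift zero b f i j

shift-cong : ∀ a b {f g} → f ≋ g → shift a b f ≋ shift a b g
shift-cong zero    zero    f≋g i       j       = f≋g i j
shift-cong (suc a) b       f≋g zero    j       = refl
shift-cong (suc a) b       f≋g (suc i) j       = shift-cong a b f≋g i j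
shift-cong zero    (suc b) f≋g i       zero    = refl
shift-cong zero    (suc b) f≋g i       (suc j) = shift-cong zero b f≋g i j

shift-vanishing : ∀ a b f i j → (∀ p q → a + p ≡ i → b + q ≡ j → f p q ≡ 0) → shift a b f i j ≡ 0
shift-vanishing zero    zero    f i       j       f≡0 = f≡0 i j refl refl
shift-vanishing (suc a) b       f zero    j       f≡0 = refl
shift-vanishing (suc a) b       f (suc i) j       f≡0 =
  shift-vanishing a b f i j λ p q a+p≡i b+q≡j → f≡0 p q (cong suc a+p≡i) b+q≡j
shift-vanishing zero    (suc b) f i       zero    f≡0 = refl
shift-vanishing zero    (suc b) f i       (suc j) f≡0 =
  shift-vanishing zero b f i j λ p q p≡i b+q≡j → f≡0 p q p≡i (cong suc b+q≡j)

shift-+ : ∀ a b f p q → shift a b f (a + p) (b + q) ≡ f p q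
shift-+ zero    zero    f p q = refl
shift-+ (suc a) b       f p q = shift-+ a b f p q
shift-+ zero    (suc b) f p q = shift-+ zero b f p q

shift-sucʳ : ∀ a b f i j → shift a (suc b) f i (suc j) ≡ shift a b f i j
shift-sucʳ zero    b f i       j = refl
shift-sucʳ (suc a) b f zero    j = refl
shift-sucʳ (suc a) b f (suc i) j = shift-sucʳ a b f i j

shift-shift : ∀ a b c d f → shift a b (shift c d f) ≋ shift (a + c) (b + d) f
shift-shift zero    zero    c d f i       j       = refl
shift-shift (suc a) b       c d f zero    j       = refl
shift-shift (suc a) b       c d f (suc i) j       = shift-shift a b c d f i j
shift-shift zero    (suc b) c d f i       zero    = sym (shift-vanishing c (suc (b + d)) f i 0 λ _ _ _ ())
shift-shift zero    (suc b) c d f i       (suc j) =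
  trans (shift-shift zero b c d f i j) (sym (shift-sucʳ c (b + d) f i j))

shift-comm : ∀ a b c d f → shift a b (shift c d f) ≋ shift c d (shift a b f)
shift-comm a b c d f i j = begin
  shift a b (shift c d f) i j   ≡⟨ shift-shift a b c d f i j ⟩
  shift (a + c) (b + d) f i j   ≡⟨ cong₂ (λ x y → shift x y f i j) (+-comm a c) (+-comm b d) ⟩
  shift (c + a) (d + b) f i j   ≡⟨ shift-shift c d a b f i j ⟨
  shift c d (shift a b f) i j   ∎
  where open ≡-Reasoning

shift-⊕ : ∀ a b f g → shift a b (f ⊕ g) ≋ shift a b f ⊕ shift a b g
shift-⊕ zero    zero    f g i       j       = refl
shift-⊕ (suc a) b       f g zero    j       = refl
shift-⊕ (suc a) b       f g (suc i) j       = shift-⊕ a b f g i j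
shift-⊕ zero    (suc b) f g i       zero    = refl
shift-⊕ zero    (suc b) f g i       (suc j) = shift-⊕ zero b f g i j

shift-⊛ : ∀ a b c f → shift a b (c ⊛ f) ≋ c ⊛ shift a b f
shift-⊛ zero    zero    c f i       j       = refl
shift-⊛ (suc a) b       c f zero    j       = sym (*-zeroʳ c)
shift-⊛ (suc a) b       c f (suc i) j       = shift-⊛ a b c f i j
shift-⊛ zero    (suc b) c f i       zero    = sym (*-zeroʳ c)
shift-⊛ zero    (suc b) c f i       (suc j) = shift-⊛ zero b c f i j

shift-∑ : ∀ a b m (F : ℕ → Coeffs) →
  shift a b (λ i j → ∑[ t < m ] F t i j) ≋ λ i j → ∑[ t < m ] shift a b (F t) i j
shift-∑ a b zero    F i j = shift-vanishing a b (λ _ _ → 0) i j λ _ _ _ _ → refl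
shift-∑ a b (suc m) F i j = trans (shift-⊕ a b (F 0) (λ i j → ∑[ t < m ] F (suc t) i j) i j)
  (cong (shift a b (F 0) i j +_) (shift-∑ a b m (F ∘ suc) i j))

-- Counting the intersection of two spheres

module _ {G : Set} (h₁ h₂ : G → ℕ) (f : Coeffs)
  (fibre↔ : ∀ i j → Σ G (λ γ → h₁ γ ≡ i × h₂ γ ≡ j) ↔ Fin (f i j)) where

  shifted-fibre↔ : ∀ a b i j →
    Σ G (λ γ → a + h₁ γ ≡ i × b + h₂ γ ≡ j) ↔ Fin (shift a b f i j)
  shifted-fibre↔ zero    zero    i       j       = fibre↔ i j
  shifted-fibre↔ (suc a) b       zero    j       = ¬⇒↔Fin0 λ { (_ , () , _) }
  shifted-fibre↔ (suc a) b       (suc i) j       =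
    ↔-trans (congˡ (suc≡suc↔≡ ×-↔ ↔-refl)) (shifted-fibre↔ a b i j)
  shifted-fibre↔ zero    (suc b) i       zero    = ¬⇒↔Fin0 λ { (_ , _ , ()) }
  shifted-fibre↔ zero    (suc b) i       (suc j) =
    ↔-trans (congˡ (↔-refl ×-↔ suc≡suc↔≡)) (shifted-fibre↔ zero b i j)

module _ {s : ℕ} where

  mismatch : Fin s → Fin s → ℕ
  mismatch x z = if does (x Fin.≟ z) then 0 else 1

  Sphere∩ : ∀ {k} → Vec (Fin s) k → Vec (Fin s) k → ℕ → ℕ → Set
  Sphere∩ {k} α β i j = Σ (Vec (Fin s) k) (λ γ → ham α γ ≡ i × ham β γ ≡ j)

  mismatch-refl : ∀ x → mismatch x x ≡ 0
  mismatch-refl x = cong (λ b → if b then 0 else 1) (dec-true (x Fin.≟ x) refl)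

  mismatch-≢ : ∀ {x z} → x ≢ z → mismatch x z ≡ 1
  mismatch-≢ {x} {z} x≢z = cong (λ b → if b then 0 else 1) (dec-false (x Fin.≟ z) x≢z)

  sphereCount : ∀ {k} → Vec (Fin s) k → Vec (Fin s) k → Coeffs
  sphereCount []       []       = one
  sphereCount (x ∷ xs) (y ∷ ys) i j =
    sum (λ z → shift (mismatch x z) (mismatch y z) (sphereCount xs ys) i j)

  Sphere∩↔Fin-sphereCount : ∀ {k} (α β : Vec (Fin s) k) i j →
    Sphere∩ α β i j ↔ Fin (sphereCount α β i j)
  Sphere∩↔Fin-sphereCount [] [] zero zero =
    mk↔ₛ′ (λ _ → Fin.zero) (λ _ → [] , refl , refl)
      (λ { Fin.zero → refl ; (Fin.suc ()) }) (λ { ([] , refl , refl) → refl })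
  Sphere∩↔Fin-sphereCount [] [] zero    (suc j) = ¬⇒↔Fin0 λ { ([] , _ , ()) }
  Sphere∩↔Fin-sphereCount [] [] (suc i) j       = ¬⇒↔Fin0 λ { ([] , () , _) }
  Sphere∩↔Fin-sphereCount (x ∷ xs) (y ∷ ys) i j =
    ↔-trans split-head
      (Σ-Fin↔Fin-sum _ _ λ z → shifted-fibre↔ (ham xs) (ham ys) (sphereCount xs ys)
        (Sphere∩↔Fin-sphereCount xs ys) (mismatch x z) (mismatch y z) i j)
    where
    split-head : Sphere∩ (x ∷ xs) (y ∷ ys) i j ↔
      Σ (Fin s) (λ z → Σ (Vec (Fin s) _) λ γ → mismatch x z + ham xs γ ≡ i × mismatch y z + ham ys γ ≡ j)
    split-head = mk↔ₛ′ (λ { (z ∷ γ , p) → z , γ , p }) (λ { (z , γ , p) → z ∷ γ , p })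
      (λ _ → refl) (λ { (z ∷ γ , p) → refl })

-- An alphabet of s = n + 2 letters.
module Alphabet (n : ℕ) where

  agree : Coeffs → Coeffs
  agree f = f ⊕ suc n ⊛ shift 1 1 f

  differ : Coeffs → Coeffs
  differ f = shift 0 1 f ⊕ shift 1 0 f ⊕ n ⊛ shift 1 1 f

  differ-cong : ∀ {f g} → f ≋ g → differ f ≋ differ g
  differ-cong f≋g i j = cong₂ _+_ (cong₂ _+_ (shift-cong 0 1 f≋g i j) (shift-cong 1 0 f≋g i j))
    (cong (n *_) (shift-cong 1 1 f≋g i j))

  agree-cong : ∀ {f g} → f ≋ g → agree f ≋ agree g
  agree-cong f≋g i j = cong₂ _+_ (f≋g i j) (cong (suc n *_) (shift-cong 1 1 f≋g i j))

  differ-⊕ : ∀ f g → differ (f ⊕ g) ≋ differ f ⊕ differ g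
  differ-⊕ f g i j = trans
    (cong₂ _+_ (cong₂ _+_ (shift-⊕ 0 1 f g i j) (shift-⊕ 1 0 f g i j)) (cong (n *_) (shift-⊕ 1 1 f g i j)))
    (rearrange n (shift 0 1 f i j) (shift 0 1 g i j) (shift 1 0 f i j) (shift 1 0 g i j)
      (shift 1 1 f i j) (shift 1 1 g i j))
    where
    rearrange : ∀ n a a′ b b′ c c′ →
      a + a′ + (b + b′) + n * (c + c′) ≡ a + b + n * c + (a′ + b′ + n * c′)
    rearrange = solve-∀

  differ-⊛ : ∀ c f → differ (c ⊛ f) ≋ c ⊛ differ f
  differ-⊛ c f i j = trans
    (cong₂ _+_ (cong₂ _+_ (shift-⊛ 0 1 c f i j) (shift-⊛ 1 0 c f i j)) (cong (n *_) (shift-⊛ 1 1 c f i j)))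
    (rearrange n c (shift 0 1 f i j) (shift 1 0 f i j) (shift 1 1 f i j))
    where
    rearrange : ∀ n c a b d → c * a + c * b + n * (c * d) ≡ c * (a + b + n * d)
    rearrange = solve-∀

  differ-shift : ∀ a b f → differ (shift a b f) ≋ shift a b (differ f)
  differ-shift a b f i j = sym (begin
    shift a b (differ f) i j
      ≡⟨ shift-⊕ a b (shift 0 1 f ⊕ shift 1 0 f) (n ⊛ shift 1 1 f) i j ⟩
    shift a b (shift 0 1 f ⊕ shift 1 0 f) i j + shift a b (n ⊛ shift 1 1 f) i j
      ≡⟨ cong₂ _+_ (shift-⊕ a b (shift 0 1 f) (shift 1 0 f) i j) (shift-⊛ a b n (shift 1 1 f) i j) ⟩
    shift a b (shift 0 1 f) i j + shift a b (shift 1 0 f) i j + n * shift a b (shift 1 1 f) i j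
      ≡⟨ cong₂ _+_ (cong₂ _+_ (shift-comm a b 0 1 f i j) (shift-comm a b 1 0 f i j))
           (cong (n *_) (shift-comm a b 1 1 f i j)) ⟩
    differ (shift a b f) i j ∎)
    where open ≡-Reasoning

  differ-agree : ∀ f → differ (agree f) ≋ agree (differ f)
  differ-agree f i j = begin
    differ (f ⊕ suc n ⊛ shift 1 1 f) i j
      ≡⟨ differ-⊕ f (suc n ⊛ shift 1 1 f) i j ⟩
    differ f i j + differ (suc n ⊛ shift 1 1 f) i j
      ≡⟨ cong (differ f i j +_) (differ-⊛ (suc n) (shift 1 1 f) i j) ⟩
    differ f i j + suc n * differ (shift 1 1 f) i j
      ≡⟨ cong (λ x → differ f i j + suc n * x) (differ-shift 1 1 f i j) ⟩
    agree (differ f) i j ∎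
    where open ≡-Reasoning

  sphereCount-agree : ∀ {k} x (xs ys : Vec (Fin (suc (suc n))) k) →
    sphereCount (x ∷ xs) (x ∷ ys) ≋ agree (sphereCount xs ys)
  sphereCount-agree x xs ys i j = sum-one-point _ x
    (cong (λ a → shift a a (sphereCount xs ys) i j) (mismatch-refl x))
    λ z x≢z → cong (λ a → shift a a (sphereCount xs ys) i j) (mismatch-≢ x≢z)

  sphereCount-differ : ∀ {k} {x y : Fin (suc (suc n))} → x ≢ y → (xs ys : Vec (Fin (suc (suc n))) k) →
    sphereCount (x ∷ xs) (y ∷ ys) ≋ differ (sphereCount xs ys)
  sphereCount-differ {x = x} {y} x≢y xs ys i j = sum-two-points _ x≢y
    (cong₂ at (mismatch-refl x) (mismatch-≢ (x≢y ∘ sym)))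
    (cong₂ at (mismatch-≢ x≢y) (mismatch-refl y))
    λ z x≢z y≢z → cong₂ at (mismatch-≢ x≢z) (mismatch-≢ y≢z)
    where
    at : ℕ → ℕ → ℕ
    at a b = shift a b (sphereCount xs ys) i j

  agree^ : ℕ → Coeffs → Coeffs
  agree^ A g = fold g agree A

  differ^ : ℕ → Coeffs
  differ^ D = fold one differ D

  differ-agree^ : ∀ A g → differ (agree^ A g) ≋ agree^ A (differ g)
  differ-agree^ zero    g i j = refl
  differ-agree^ (suc A) g i j =
    trans (differ-agree (agree^ A g) i j) (agree-cong (differ-agree^ A g) i j)

  sphereCount≋agree^-differ^ : ∀ {k} (α β : Vec (Fin (suc (suc n))) k) →
    Σ ℕ λ A → A + ham α β ≡ k × sphereCount α β ≋ agree^ A (differ^ (ham α β))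
  sphereCount≋agree^-differ^ [] [] = 0 , refl , λ i j → refl
  sphereCount≋agree^-differ^ (x ∷ xs) (y ∷ ys) with x Fin.≟ y | sphereCount≋agree^-differ^ xs ys
  ... | yes refl | A , A+d≡k , count≋ = suc A , cong suc A+d≡k ,
    λ i j → trans (sphereCount-agree x xs ys i j) (agree-cong count≋ i j)
  ... | no x≢y   | A , A+d≡k , count≋ = A , trans (+-suc A _) (cong suc A+d≡k) ,
    λ i j → trans (sphereCount-differ x≢y xs ys i j)
      (trans (differ-cong count≋ i j) (differ-agree^ A _ i j))

  agree^-binomial : ∀ A g →
    agree^ A g ≋ λ i j → ∑[ t < suc A ] ((A C t) * (suc n ^ t * shift t t g i j))
  agree^-binomial zero    g i j = sym (trans (+-identityʳ _) (trans (*-identityˡ _) (*-identityˡ _)))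
  agree^-binomial (suc A) g i j = begin
    agree (agree^ A g) i j
      ≡⟨ agree-cong (agree^-binomial A g) i j ⟩
    sumBelow (suc A) (λ t → (A C t) * w t) + suc n * shift 1 1 (λ i j → sumBelow (suc A) (λ t → F t i j)) i j
      ≡⟨ cong (λ x → sumBelow (suc A) (λ t → (A C t) * w t) + suc n * x) (shift-∑ 1 1 (suc A) F i j) ⟩
    sumBelow (suc A) (λ t → (A C t) * w t) + suc n * ∑[ t < suc A ] shift 1 1 (F t) i j
      ≡⟨ cong (λ x → sumBelow (suc A) (λ t → (A C t) * w t) + x)
           (trans (sym (sumBelow-* (suc A) (suc n) (λ t → shift 1 1 (F t) i j)))
                  (sumBelow-cong (suc A) λ t _ → shifted-term t)) ⟩
    sumBelow (suc A) (λ t → (A C t) * w t) + sumBelow (suc A) (λ t → (A C t) * w (suc t))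
      ≡⟨ sumBelow-pascal A w ⟨
    ∑[ t < suc (suc A) ] ((suc A C t) * w t) ∎
    where
    open ≡-Reasoning
    w : ℕ → ℕ
    w t = suc n ^ t * shift t t g i j
    F : ℕ → Coeffs
    F t = (A C t) ⊛ (suc n ^ t ⊛ shift t t g)
    shifted-term : ∀ t → suc n * shift 1 1 (F t) i j ≡ (A C t) * w (suc t)
    shifted-term t = begin
      suc n * shift 1 1 (F t) i j
        ≡⟨ cong (suc n *_) (shift-⊛ 1 1 (A C t) _ i j) ⟩
      suc n * ((A C t) * shift 1 1 (suc n ^ t ⊛ shift t t g) i j)
        ≡⟨ cong (λ x → suc n * ((A C t) * x)) (shift-⊛ 1 1 (suc n ^ t) _ i j) ⟩
      suc n * ((A C t) * (suc n ^ t * shift 1 1 (shift t t g) i j))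
        ≡⟨ cong (λ x → suc n * ((A C t) * (suc n ^ t * x))) (shift-shift 1 1 t t g i j) ⟩
      suc n * ((A C t) * (suc n ^ t * shift (suc t) (suc t) g i j))
        ≡⟨ rearrange (suc n) (A C t) (suc n ^ t) (shift (suc t) (suc t) g i j) ⟩
      (A C t) * w (suc t) ∎
      where
      rearrange : ∀ m c p x → m * (c * (p * x)) ≡ c * (m * p * x)
      rearrange = solve-∀

  spread : ℕ → ℕ → ℕ
  spread m c = ((m + c) C c) * n ^ c

  spread-rec : ∀ m c → spread (suc m) c ≡ spread m c + n * lower (spread (suc m)) c
  spread-rec m zero    = cong suc (sym (*-zeroʳ n))
  spread-rec m (suc c) = begin
    (suc (m + suc c) C suc c) * (n * n ^ c)
      ≡⟨ cong (_* (n * n ^ c)) (sym (nCk+nC[k+1]≡[n+1]C[k+1] (m + suc c) c)) ⟩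
    ((m + suc c) C c + (m + suc c) C suc c) * (n * n ^ c)
      ≡⟨ cong (λ l → (l C c + (m + suc c) C suc c) * (n * n ^ c)) (+-suc m c) ⟩
    ((suc m + c) C c + (m + suc c) C suc c) * (n * n ^ c)
      ≡⟨ rearrange ((suc m + c) C c) ((m + suc c) C suc c) n (n ^ c) ⟩
    spread m (suc c) + n * spread (suc m) c ∎
    where
    open ≡-Reasoning
    rearrange : ∀ x y n p → (x + y) * (n * p) ≡ y * (n * p) + n * (x * p)
    rearrange = solve-∀

  -- At the differing positions γ copies α a times, β b times and neither c times,
  -- so that d(α,γ) = b + c and d(β,γ) = a + c.
  trinomial : ℕ → ℕ → ℕ → ℕ
  trinomial a b c = ((a + b) C a) * spread (a + b) c

  a+b≡1+m⇒trinomial-rec : ∀ a b c m → a + b ≡ suc m →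
    trinomial a b c ≡
    lower (λ a′ → trinomial a′ b c) a + lower (λ b′ → trinomial a b′ c) b + n * lower (trinomial a b) c
  a+b≡1+m⇒trinomial-rec a b c m a+b≡1+m = begin
    P * spread (a + b) c
      ≡⟨ cong (λ l → P * spread l c) a+b≡1+m ⟩
    P * spread (suc m) c
      ≡⟨ cong (P *_) (spread-rec m c) ⟩
    P * (spread m c + n * L)
      ≡⟨ cong (_* (spread m c + n * L)) (binomial-rec a b 0<a+b) ⟩
    (Pᵃ + Pᵇ) * (spread m c + n * L)
      ≡⟨ rearrange Pᵃ Pᵇ (spread m c) n L ⟩
    Pᵃ * spread m c + Pᵇ * spread m c + n * ((Pᵃ + Pᵇ) * L)
      ≡⟨ cong (λ x → Pᵃ * spread m c + Pᵇ * spread m c + n * (x * L)) (sym (binomial-rec a b 0<a+b)) ⟩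
    Pᵃ * spread m c + Pᵇ * spread m c + n * (P * L)
      ≡⟨ cong₂ _+_ (cong₂ _+_ (lowerᵃ a a+b≡1+m) (lowerᵇ b a+b≡1+m)) (cong (n *_) (lowerᶜ c)) ⟩
    lower (λ a′ → trinomial a′ b c) a + lower (λ b′ → trinomial a b′ c) b + n * lower (trinomial a b) c ∎
    where
    open ≡-Reasoning
    P Pᵃ Pᵇ L : ℕ
    P  = (a + b) C a
    Pᵃ = lower (λ a′ → (a′ + b) C a′) a
    Pᵇ = lower (λ b′ → (a + b′) C a) b
    L  = lower (spread (suc m)) c
    0<a+b : 0 < a + b
    0<a+b = subst (0 <_) (sym a+b≡1+m) (s≤s z≤n)
    rearrange : ∀ x y s n l → (x + y) * (s + n * l) ≡ x * s + y * s + n * ((x + y) * l)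
    rearrange = solve-∀
    lowerᵃ : ∀ a → a + b ≡ suc m →
      lower (λ a′ → (a′ + b) C a′) a * spread m c ≡ lower (λ a′ → trinomial a′ b c) a
    lowerᵃ zero    _   = refl
    lowerᵃ (suc a) a+b≡1+m = cong (λ l → ((a + b) C a) * spread l c) (sym (suc-injective a+b≡1+m))
    lowerᵇ : ∀ b → a + b ≡ suc m →
      lower (λ b′ → (a + b′) C a) b * spread m c ≡ lower (λ b′ → trinomial a b′ c) b
    lowerᵇ zero    _   = refl
    lowerᵇ (suc b) a+b≡1+m =
      cong (λ l → ((a + b) C a) * spread l c) (sym (suc-injective (trans (sym (+-suc a b)) a+b≡1+m)))
    lowerᶜ : ∀ c → P * lower (spread (suc m)) c ≡ lower (trinomial a b) c
    lowerᶜ zero    = *-zeroʳ P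
    lowerᶜ (suc c) = cong (λ l → P * spread l c) (sym a+b≡1+m)

  trinomial-rec : ∀ a b c → 0 < a + b + c →
    trinomial a b c ≡
    lower (λ a′ → trinomial a′ b c) a + lower (λ b′ → trinomial a b′ c) b + n * lower (trinomial a b) c
  trinomial-rec zero zero (suc c) _ = begin
    1 * ((suc c C suc c) * (n * n ^ c))  ≡⟨ cong (λ x → 1 * (x * (n * n ^ c))) (nCn≡1 (suc c)) ⟩
    1 * (1 * (n * n ^ c))                ≡⟨ rearrange n (n ^ c) ⟩
    n * (1 * (1 * n ^ c))                ≡⟨ cong (λ x → n * (1 * (x * n ^ c))) (sym (nCn≡1 c)) ⟩
    n * trinomial 0 0 c                  ∎
    where
    open ≡-Reasoning
    rearrange : ∀ n p → 1 * (1 * (n * p)) ≡ n * (1 * (1 * p))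
    rearrange = solve-∀
  trinomial-rec (suc a) b       c _ = a+b≡1+m⇒trinomial-rec (suc a) b c (a + b) refl
  trinomial-rec zero    (suc b) c _ = a+b≡1+m⇒trinomial-rec zero (suc b) c b refl

  data Outside (D p q : ℕ) : Set where
    below  : p + q < D → Outside D p q
    aboveˡ : D < p → Outside D p q
    aboveʳ : D < q → Outside D p q

  outside-lowerʳ : ∀ {D p q} → Outside (suc D) p (suc q) → Outside D p q
  outside-lowerʳ {D} {p} {q} (below p+q<D) = below (≤-pred (subst (_< suc D) (+-suc p q) p+q<D))
  outside-lowerʳ (aboveˡ D<p) = aboveˡ (<⇒≤ D<p)
  outside-lowerʳ (aboveʳ D<q) = aboveʳ (≤-pred D<q)

  outside-lowerˡ : ∀ {D p q} → Outside (suc D) (suc p) q → Outside D p q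
  outside-lowerˡ (below p+q<D) = below (≤-pred p+q<D)
  outside-lowerˡ (aboveˡ D<p) = aboveˡ (≤-pred D<p)
  outside-lowerˡ (aboveʳ D<q) = aboveʳ (<⇒≤ D<q)

  outside-lower : ∀ {D p q} → Outside (suc D) (suc p) (suc q) → Outside D p q
  outside-lower {D} {p} {q} (below p+q<D) =
    below (<-trans (+-monoʳ-< p (n<1+n q)) (≤-pred p+q<D))
  outside-lower (aboveˡ D<p) = aboveˡ (≤-pred D<p)
  outside-lower (aboveʳ D<q) = aboveʳ (≤-pred D<q)

  differ^-outside : ∀ D p q → Outside D p q → differ^ D p q ≡ 0
  differ^-outside zero (suc p) q       (aboveˡ _) = refl
  differ^-outside zero zero    (suc q) (aboveʳ _) = refl
  differ^-outside zero (suc p) (suc q) (aboveʳ _) = refl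
  differ^-outside (suc D) p q out =
    trans (cong₂ _+_ (cong₂ _+_ (via01 p q out) (via10 p q out)) (cong (n *_) (via11 p q out))) (*-zeroʳ n)
    where
    via01 : ∀ p q → Outside (suc D) p q → shift 0 1 (differ^ D) p q ≡ 0
    via01 p zero    _   = refl
    via01 p (suc q) out = differ^-outside D p q (outside-lowerʳ out)
    via10 : ∀ p q → Outside (suc D) p q → shift 1 0 (differ^ D) p q ≡ 0
    via10 zero    q _   = refl
    via10 (suc p) q out = differ^-outside D p q (outside-lowerˡ out)
    via11 : ∀ p q → Outside (suc D) p q → shift 1 1 (differ^ D) p q ≡ 0
    via11 zero    q       _   = refl
    via11 (suc p) zero    _   = refl
    via11 (suc p) (suc q) out = differ^-outside D p q (outside-lower out)

  differ^-trinomial : ∀ D a b c → a + b + c ≡ D → differ^ D (b + c) (a + c) ≡ trinomial a b c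
  differ^-trinomial zero zero zero zero refl = refl
  differ^-trinomial (suc D) a b c a+b+c≡1+D = begin
    differ^ (suc D) (b + c) (a + c)
      ≡⟨ cong₂ _+_ (cong₂ _+_ (via01 a b c a+b+c≡1+D) (via10 a b c a+b+c≡1+D))
                   (cong (n *_) (via11 a b c a+b+c≡1+D)) ⟩
    lower (λ a′ → trinomial a′ b c) a + lower (λ b′ → trinomial a b′ c) b + n * lower (trinomial a b) c
      ≡⟨ trinomial-rec a b c (subst (0 <_) (sym a+b+c≡1+D) (s≤s z≤n)) ⟨
    trinomial a b c ∎
    where
    open ≡-Reasoning
    D<1+D : ∀ {x} → x ≡ suc D → D < x
    D<1+D x≡1+D = subst (D <_) (sym x≡1+D) (n<1+n D)
    via01 : ∀ a b c → a + b + c ≡ suc D →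
      shift 0 1 (differ^ D) (b + c) (a + c) ≡ lower (λ a′ → trinomial a′ b c) a
    via01 (suc a) b c       e = differ^-trinomial D a b c (suc-injective e)
    via01 zero    b zero    e = refl
    via01 zero    b (suc c) e = differ^-outside D (b + suc c) c (aboveˡ (D<1+D e))
    via10 : ∀ a b c → a + b + c ≡ suc D →
      shift 1 0 (differ^ D) (b + c) (a + c) ≡ lower (λ b′ → trinomial a b′ c) b
    via10 a (suc b) c       e = differ^-trinomial D a b c (suc-injective (trans (cong (_+ c) (sym (+-suc a b))) e))
    via10 a zero    zero    e = refl
    via10 a zero    (suc c) e = differ^-outside D c (a + suc c)
      (aboveʳ (D<1+D (trans (cong (_+ suc c) (sym (+-identityʳ a))) e)))
    via11 : ∀ a b c → a + b + c ≡ suc D →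
      shift 1 1 (differ^ D) (b + c) (a + c) ≡ lower (trinomial a b) c
    via11 a b (suc c) e rewrite +-suc b c | +-suc a c =
      differ^-trinomial D a b c (suc-injective (trans (sym (+-suc (a + b) c)) e))
    via11 a b zero e rewrite +-identityʳ b | +-identityʳ a = corner a b (trans (sym (+-identityʳ (a + b))) e)
      where
      corner : ∀ a b → a + b ≡ suc D → shift 1 1 (differ^ D) b a ≡ 0
      corner a       zero    _ = refl
      corner zero    (suc b) _ = refl
      corner (suc a) (suc b) e = differ^-outside D b a
        (below (subst₂ _<_ (+-comm a b) (trans (sym (+-suc a b)) (suc-injective e)) (n<1+n (a + b))))

  shift-differ^-below : ∀ D t i j → i + j < D + 2 * t → shift t t (differ^ D) i j ≡ 0
  shift-differ^-below D t i j i+j<D+2t = shift-vanishing t t (differ^ D) i j λ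
    { p q refl refl → differ^-outside D p q (below (+-cancelʳ-< (2 * t) (p + q) D
        (subst (_< D + 2 * t) (rearrange t p q) i+j<D+2t))) }
    where
    rearrange : ∀ t p q → t + p + (t + q) ≡ p + q + 2 * t
    rearrange = solve-∀

  -- The first three factors of `term`. With the integers a = D + t − i and b = D + t − j its binomial
  -- is Cℤ (a + b) a, which vanishes unless a and b are nonnegative.
  differTerm : ℕ → ℕ → ℕ → ℕ → ℕ → ℕ
  differTerm D t i j w = Cℤ (pos (2 * D + 2 * t) ℤ.- pos (i + j)) (pos (D + t) ℤ.- pos i) * (D C w) * n ^ w

  differTerm-aboveˡ : ∀ D t i j w → D + t < i → differTerm D t i j w ≡ 0
  differTerm-aboveˡ D t i j w D+t<i with m≤n⇒∃[o]m+o≡n D+t<i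
  ... | r , refl = trans
    (cong (λ x → Cℤ (pos (2 * D + 2 * t) ℤ.- pos (suc (D + t + r) + j)) x * (D C w) * n ^ w)
      (pos-m-pos[1+m+r]≡-[1+r] (D + t) r))
    (cong (λ x → x * (D C w) * n ^ w) (Cℤ-negʳ (pos (2 * D + 2 * t) ℤ.- pos (suc (D + t + r) + j)) r))

  differTerm-aboveʳ : ∀ D t i j w → i ≤ D + t → D + t < j → differTerm D t i j w ≡ 0
  differTerm-aboveʳ D t i j w i≤D+t D+t<j with m≤n⇒∃[o]m+o≡n i≤D+t | m≤n⇒∃[o]m+o≡n D+t<j
  ... | x , i+x≡D+t | r , refl = trans
    (cong (λ y → Cℤ (pos (2 * D + 2 * t) ℤ.- pos (i + j′)) y * (D C w) * n ^ w)
      (trans (cong (λ m → pos m ℤ.- pos i) (sym i+x≡D+t)) (pos[m+n]-pos-m≡pos-n i x)))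
    (cong (λ y → y * (D C w) * n ^ w) (Cℤ-vanishing (2 * D + 2 * t) (i + j′) x r balance))
    where
    j′ : ℕ
    j′ = suc (D + t + r)
    balance : 2 * D + 2 * t + suc r ≡ i + j′ + x
    balance = begin
      2 * D + 2 * t + suc r  ≡⟨ double D t r ⟩
      D + t + j′             ≡⟨ cong (_+ j′) (sym i+x≡D+t) ⟩
      i + x + j′             ≡⟨ swap i x j′ ⟩
      i + j′ + x             ∎
      where
      open ≡-Reasoning
      double : ∀ D t r → 2 * D + 2 * t + suc r ≡ D + t + suc (D + t + r)
      double = solve-∀
      swap : ∀ a b c → a + b + c ≡ a + c + b
      swap = solve-∀

  differTerm-inside : ∀ x y w t →
    differTerm (x + y + w) t (t + (y + w)) (t + (x + w)) w ≡ trinomial x y w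
  differTerm-inside x y w t = begin
    Cℤ (pos (2 * D + 2 * t) ℤ.- pos I) (pos (D + t) ℤ.- pos i) * (D C w) * n ^ w
      ≡⟨ cong₂ (λ X U → Cℤ (pos X ℤ.- pos I) (pos U ℤ.- pos i) * (D C w) * n ^ w)
           (first x y w t) (second x y w t) ⟩
    Cℤ (pos (I + (x + y)) ℤ.- pos I) (pos (i + x) ℤ.- pos i) * (D C w) * n ^ w
      ≡⟨ cong₂ (λ X U → Cℤ X U * (D C w) * n ^ w) (pos[m+n]-pos-m≡pos-n I (x + y)) (pos[m+n]-pos-m≡pos-n i x) ⟩
    ((x + y) C x) * (D C w) * n ^ w
      ≡⟨ *-assoc ((x + y) C x) (D C w) (n ^ w) ⟩
    trinomial x y w ∎
    where
    open ≡-Reasoning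
    D i I : ℕ
    D = x + y + w
    i = t + (y + w)
    I = t + (y + w) + (t + (x + w))
    first : ∀ x y w t → 2 * (x + y + w) + 2 * t ≡ t + (y + w) + (t + (x + w)) + (x + y)
    first = solve-∀
    second : ∀ x y w t → x + y + w + t ≡ t + (y + w) + x
    second = solve-∀

  shift-differ^-aboveˡ : ∀ D t i j → D + t < i → shift t t (differ^ D) i j ≡ 0
  shift-differ^-aboveˡ D t i j D+t<i = shift-vanishing t t (differ^ D) i j λ p q t+p≡i _ →
    differ^-outside D p q (aboveˡ (+-cancelˡ-< t D p (subst₂ _<_ (+-comm D t) (sym t+p≡i) D+t<i)))

  shift-differ^-aboveʳ : ∀ D t i j → D + t < j → shift t t (differ^ D) i j ≡ 0
  shift-differ^-aboveʳ D t i j D+t<j = shift-vanishing t t (differ^ D) i j λ p q _ t+q≡j →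
    differ^-outside D p q (aboveʳ (+-cancelˡ-< t D q (subst₂ _<_ (+-comm D t) (sym t+q≡j) D+t<j)))

  differTerm≡shift-differ^-inside : ∀ {D t i j w} x y → x + y + w ≡ D → t + (y + w) ≡ i → t + (x + w) ≡ j →
    differTerm D t i j w ≡ shift t t (differ^ D) i j
  differTerm≡shift-differ^-inside {t = t} {w = w} x y refl refl refl = begin
    differTerm (x + y + w) t (t + (y + w)) (t + (x + w)) w   ≡⟨ differTerm-inside x y w t ⟩
    trinomial x y w                                            ≡⟨ differ^-trinomial (x + y + w) x y w refl ⟨
    differ^ (x + y + w) (y + w) (x + w)                        ≡⟨ shift-+ t t (differ^ (x + y + w)) (y + w) (x + w) ⟨
    shift t t (differ^ (x + y + w)) (t + (y + w)) (t + (x + w)) ∎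
    where open ≡-Reasoning

  differTerm≡shift-differ^ : ∀ D t i j w → D + 2 * t + w ≡ i + j →
    differTerm D t i j w ≡ shift t t (differ^ D) i j
  differTerm≡shift-differ^ D t i j w D+2t+w≡i+j with i ≤? D + t | j ≤? D + t
  ... | no i≰D+t | _ = trans (differTerm-aboveˡ D t i j w (≰⇒> i≰D+t)) (sym (shift-differ^-aboveˡ D t i j (≰⇒> i≰D+t)))
  ... | yes i≤D+t | no j≰D+t =
    trans (differTerm-aboveʳ D t i j w i≤D+t (≰⇒> j≰D+t)) (sym (shift-differ^-aboveʳ D t i j (≰⇒> j≰D+t)))
  ... | yes i≤D+t | yes j≤D+t with m≤n⇒∃[o]m+o≡n i≤D+t | m≤n⇒∃[o]m+o≡n j≤D+t
  ...   | x , i+x≡D+t | y , j+y≡D+t = differTerm≡shift-differ^-inside x y D≡ i≡ j≡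
    where
    open ≡-Reasoning
    regroup₁ : ∀ D t w x y → D + 2 * t + (x + y + w) ≡ D + 2 * t + w + x + y
    regroup₁ = solve-∀
    regroup₂ : ∀ i j x y → i + j + x + y ≡ (i + x) + (j + y)
    regroup₂ = solve-∀
    regroup₃ : ∀ D t → (D + t) + (D + t) ≡ D + 2 * t + D
    regroup₃ = solve-∀
    regroup₄ : ∀ t x y w → t + (y + w) + x ≡ x + y + w + t
    regroup₄ = solve-∀
    regroup₅ : ∀ t x y w → t + (x + w) + y ≡ x + y + w + t
    regroup₅ = solve-∀
    D≡ : x + y + w ≡ D
    D≡ = +-cancelˡ-≡ (D + 2 * t) (x + y + w) D (begin
      D + 2 * t + (x + y + w)   ≡⟨ regroup₁ D t w x y ⟩
      D + 2 * t + w + x + y     ≡⟨ cong (λ m → m + x + y) D+2t+w≡i+j ⟩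
      i + j + x + y             ≡⟨ regroup₂ i j x y ⟩
      (i + x) + (j + y)         ≡⟨ cong₂ _+_ i+x≡D+t j+y≡D+t ⟩
      (D + t) + (D + t)         ≡⟨ regroup₃ D t ⟩
      D + 2 * t + D             ∎)
    i≡ : t + (y + w) ≡ i
    i≡ = +-cancelʳ-≡ x _ _ (trans (regroup₄ t x y w) (trans (cong (_+ t) D≡) (sym i+x≡D+t)))
    j≡ : t + (x + w) ≡ j
    j≡ = +-cancelʳ-≡ y _ _ (trans (regroup₅ t x y w) (trans (cong (_+ t) D≡) (sym j+y≡D+t)))

  binomialSummand : ℕ → ℕ → ℕ → ℕ → ℕ → ℕ
  binomialSummand A D i j t = (A C t) * (suc n ^ t * shift t t (differ^ D) i j)

  binomialSummand-vanishing : ∀ A D i j t → shift t t (differ^ D) i j ≡ 0 → binomialSummand A D i j t ≡ 0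
  binomialSummand-vanishing A D i j t shift≡0 = begin
    (A C t) * (suc n ^ t * shift t t (differ^ D) i j)  ≡⟨ cong (λ x → (A C t) * (suc n ^ t * x)) shift≡0 ⟩
    (A C t) * (suc n ^ t * 0)                          ≡⟨ cong ((A C t) *_) (*-zeroʳ (suc n ^ t)) ⟩
    (A C t) * 0                                        ≡⟨ *-zeroʳ (A C t) ⟩
    0                                                  ∎
    where open ≡-Reasoning

  term≡binomialSummand : ∀ A D i j t → D + 2 * t ≤ i + j → term (suc (suc n)) (A + D) D i j t ≡ binomialSummand A D i j t
  term≡binomialSummand A D i j t D+2t≤i+j with m≤n⇒∃[o]m+o≡n D+2t≤i+j
  ... | w , D+2t+w≡i+j = begin
    differTerm D t i j e * ((A + D ∸ D) C t) * suc n ^ t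
      ≡⟨ cong₂ (λ e′ k → differTerm D t i j e′ * (k C t) * suc n ^ t) e≡w (m+n∸n≡m A D) ⟩
    differTerm D t i j w * (A C t) * suc n ^ t
      ≡⟨ cong (λ x → x * (A C t) * suc n ^ t) (differTerm≡shift-differ^ D t i j w D+2t+w≡i+j) ⟩
    shift t t (differ^ D) i j * (A C t) * suc n ^ t
      ≡⟨ rearrange (shift t t (differ^ D) i j) (A C t) (suc n ^ t) ⟩
    binomialSummand A D i j t ∎
    where
    open ≡-Reasoning
    e : ℕ
    e = (i + j ∸ D) ∸ 2 * t
    e≡w : e ≡ w
    e≡w = begin
      (i + j ∸ D) ∸ 2 * t          ≡⟨ cong (λ m → (m ∸ D) ∸ 2 * t) (sym D+2t+w≡i+j) ⟩
      (D + 2 * t + w ∸ D) ∸ 2 * t  ≡⟨ cong (_∸ 2 * t) (trans (cong (_∸ D) (+-assoc D (2 * t) w)) (m+n∸m≡n D (2 * t + w))) ⟩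
      (2 * t + w) ∸ 2 * t          ≡⟨ m+n∸m≡n (2 * t) w ⟩
      w                            ∎
    rearrange : ∀ x c p → x * c * p ≡ c * (p * x)
    rearrange = solve-∀

  formula≡agree^-differ^ : ∀ A D i j → formula (suc (suc n)) (A + D) D i j ≡ agree^ A (differ^ D) i j
  formula≡agree^-differ^ A D i j with i + j <ᵇ D in i+j<ᵇD
  ... | true = sym (trans (agree^-binomial A (differ^ D) i j) (sumBelow-zero (suc A) λ t →
      binomialSummand-vanishing A D i j t (shift-differ^-below D t i j (≤-trans i+j<D (m≤m+n D (2 * t))))))
    where
    i+j<D : i + j < D
    i+j<D = <ᵇ⇒< (i + j) D (subst T (sym i+j<ᵇD) tt)
  ... | false = begin
    sumList (map (term (suc (suc n)) (A + D) D i j) (upTo (suc X)))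
      ≡⟨ sum-map-upTo (term (suc (suc n)) (A + D) D i j) (suc X) ⟩
    sumBelow (suc X) (term (suc (suc n)) (A + D) D i j)
      ≡⟨ sumBelow-cong (suc X) (λ t t≤X → term≡binomialSummand A D i j t (in-range t (≤-pred t≤X))) ⟩
    sumBelow (suc X) (binomialSummand A D i j)
      ≡⟨ sumBelow-support (suc X) (suc A) beyond-X beyond-A ⟩
    sumBelow (suc A) (binomialSummand A D i j)
      ≡⟨ agree^-binomial A (differ^ D) i j ⟨
    agree^ A (differ^ D) i j ∎
    where
    open ≡-Reasoning
    X : ℕ
    X = (i + j ∸ D) / 2
    D≤i+j : D ≤ i + j
    D≤i+j = ≮⇒≥ λ i+j<D → subst T i+j<ᵇD (<⇒<ᵇ i+j<D)
    in-range : ∀ t → t ≤ X → D + 2 * t ≤ i + j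
    in-range t t≤X = subst (D + 2 * t ≤_) (m+[n∸m]≡n D≤i+j) (+-monoʳ-≤ D (≤-half⇒double≤ _ t t≤X))
    beyond-X : ∀ t → suc X ≤ t → binomialSummand A D i j t ≡ 0
    beyond-X t X<t with D + 2 * t ≤? i + j
    ... | yes D+2t≤i+j = ⊥-elim (<⇒≱ X<t (double≤⇒≤-half _ t
          (+-cancelˡ-≤ D (2 * t) _ (subst (D + 2 * t ≤_) (sym (m+[n∸m]≡n D≤i+j)) D+2t≤i+j))))
    ... | no D+2t≰i+j = binomialSummand-vanishing A D i j t (shift-differ^-below D t i j (≰⇒> D+2t≰i+j))
    beyond-A : ∀ t → suc A ≤ t → binomialSummand A D i j t ≡ 0
    beyond-A t A<t = k>n⇒nCk*m≡0 A t A<t _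

theorem3 : (s k : ℕ) → 2 ≤ s → 1 ≤ k → (α β : Vec (Fin s) k) → (d : ℕ) →
    ham α β ≡ d → (i j : ℕ) →
    (Σ (Vec (Fin s) k) (λ γ → ham α γ ≡ i × ham β γ ≡ j)) ↔ Fin (formula s k d i j)
theorem3 (suc (suc n)) k (s≤s (s≤s z≤n)) _ α β d refl i j =
  subst (λ m → Sphere∩ α β i j ↔ Fin m) count≡formula (Sphere∩↔Fin-sphereCount α β i j)
  where
  open Alphabet n
  count≡formula : sphereCount α β i j ≡ formula (suc (suc n)) k d i j
  count≡formula with sphereCount≋agree^-differ^ α β
  ... | A , A+d≡k , count≋ = begin
    sphereCount α β i j                    ≡⟨ count≋ i j ⟩
    agree^ A (differ^ d) i j               ≡⟨ formula≡agree^-differ^ A d i j ⟨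
    formula (suc (suc n)) (A + d) d i j    ≡⟨ cong (λ m → formula (suc (suc n)) m d i j) A+d≡k ⟩
    formula (suc (suc n)) k d i j          ∎
    where open ≡-Reasoning
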